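{- Let $g_{n,p,q}$, $c_{n,i}$, $d_{n,i}$ be as defined in the context. Then: (a) $d_{n,i}=d_{n-1,i}+c_{n-1,i-1}$ for all $n$ and $i$ with $2\le i\le n$. (b) $g_{n,i,n}=0$ for all $n\ge 1$ and all $i\ge 0$ with $i\ne n-1$. (c) $g_{n,0,1}=d_{n,1}=c_{n,1}=d_{n,n}=c_{n,n}=1$ for all $n\ge 1$. (d) $g_{n,p,q}=g_{n,p+2,q+1}$ whenever $3\le p+2<q+1\le n$. (e) $g_{n,0,q}=g_{n,0,q+1}+g_{n,1,q+1}+g_{n,2,q+1}$ whenever $2\le q\le n-1$. (f) $\sum_{i=0}^{k}g_{n,i,q}=\sum_{i=0}^{k+2}g_{n,i,q+1}$ for all $n\ge 1$, $q\ge 0$ and integers $k$ with $0\le k\le q-2$. (g) $c_{n,i}=c_{n,i-1}-d_{n,i-1}$ for all $n$ and $i$ with $3\le i\le n$.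
   Context: Define integers $g_{n,p,q}$ for integers $n$ and non-negative integers $p,q$ recursively by: $g_{n,p,q}=0$ if $n\le 0$; $g_{n,p,q}=0$ if $p\ge q$; for $n=1$: $g_{1,0,1}=1$ and $g_{1,p,q}=0$ for $(p,q)\ne(0,1)$; for $n\ge 2$ and $p<q$: $$g_{n,0,q}=g_{n-1,0,q}+\sum_{i=1}^{n-q} i\, g_{n-1,i,q-1+i}\quad (p=0),$$ $$g_{n,p,q}=g_{n-1,p,q}+\sum_{i=0}^{p-1} g_{n-1,i,q-1}\quad (p>0),$$ where sums with upper limit smaller than lower limit are empty. (Equivalently, $g_{n,p,q}$ is the number of nodes labelled $(p,q)$ at level $n$ of the generating tree with root $(0,1)$ and rule $(p,q)\to (0,1+q-p)$ [$p$ copies], $(p,q)$, $(p+1,q+1),(p+2,q+1),\dots,(q,q+1)$.) Define $d_{n,i}=g_{n,i-1,i}$ and $c_{n,i}=\sum_{k=0}^{i-1}g_{n,k,i}$. -}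

module Defs where

open import Data.Nat using (ℕ; zero; suc; _+_; _*_; _∸_; _<ᵇ_)
open import Data.Bool using (if_then_else_)

sumBelow : (ℕ → ℕ) → ℕ → ℕ
sumBelow f zero = 0
sumBelow f (suc k) = sumBelow f k + f k

-- g n p q  (the integer n ≤ 0 case is represented by n = 0, where g = 0)
g : ℕ → ℕ → ℕ → ℕ
g zero p q = 0
g (suc zero) zero (suc zero) = 1
g (suc zero) _ _ = 0
g (suc (suc m)) zero q =
  if 0 <ᵇ q
  then g (suc m) 0 q
       + sumBelow (λ j → suc j * g (suc m) (suc j) ((q ∸ 1) + suc j)) (suc (suc m) ∸ q)
  else 0
g (suc (suc m)) (suc p') q =
  if suc p' <ᵇ q
  then g (suc m) (suc p') q + sumBelow (λ i → g (suc m) i (q ∸ 1)) (suc p')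
  else 0

d : ℕ → ℕ → ℕ
d n i = g n (i ∸ 1) i

c : ℕ → ℕ → ℕ
c n i = sumBelow (λ k → g n k i) i

module Submission where

-- The numbers g n p q count the nodes labelled (p , q) at level n of a
-- generating tree; all seven parts of the lemma are consequences of two
-- structural identities which hold at every level n:
--
--   Shift:  g(n, p+1, r+3) = g(n, p+3, r+4)      for p ≤ r,
--   Head:   g(n, 0, r+2)   = Σ_{j<n} g(n, j+2, j+r+3).
--
-- At a fixed level, Shift and Head give the column recurrence (e); summing
-- Shift along a column then gives the partial-sum identity (f); iterating (f)
-- evaluates every diagonal sum of the table.  Unfolding the recursion for g,
-- Shift at level n+1 follows from Shift and (f) at level n, and Head at level
-- n+1 follows from Head and the diagonal sums at level n after rearranging
-- the weighted sum Σ (l+1)·a_l in the recursion for row 0 into a sum of tails.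

open import Defs
open import Data.Nat using (ℕ; zero; suc; _+_; _*_; _∸_; _≤_; _<_; z≤n; s≤s; _<ᵇ_)
open import Data.Nat.Properties
open import Data.Bool using (Bool; true; false; T; if_then_else_)
open import Data.Sum using (inj₁; inj₂)
open import Data.Product using (_×_; _,_; proj₁; proj₂)
open import Data.Empty using (⊥-elim)
open import Relation.Nullary using (¬_)
open import Relation.Binary using (tri<; tri≈; tri>)
open import Relation.Binary.PropositionalEquality
open import Algebra.Properties.CommutativeSemigroup +-commutativeSemigroup using (interchange)
open import Data.Nat.Solver using (module +-*-Solver)
open +-*-Solver using (solve; _:+_; _:=_)

sum-cong< : ∀ {f h : ℕ → ℕ} N → (∀ k → k < N → f k ≡ h k) → sumBelow f N ≡ sumBelow h N
sum-cong< zero    _  = refl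
sum-cong< (suc N) eq = cong₂ _+_ (sum-cong< N (λ k k<N → eq k (m<n⇒m<1+n k<N))) (eq N ≤-refl)

sum-cong : ∀ {f h : ℕ → ℕ} → (∀ k → f k ≡ h k) → ∀ N → sumBelow f N ≡ sumBelow h N
sum-cong eq N = sum-cong< N (λ k _ → eq k)

sum-zero : ∀ {f : ℕ → ℕ} N → (∀ k → k < N → f k ≡ 0) → sumBelow f N ≡ 0
sum-zero zero    _    = refl
sum-zero (suc N) vanish = cong₂ _+_ (sum-zero N (λ k k<N → vanish k (m<n⇒m<1+n k<N))) (vanish N ≤-refl)

sum-tail-zero : ∀ {f : ℕ → ℕ} X Y → (∀ k → X ≤ k → f k ≡ 0) → X ≤ Y → sumBelow f Y ≡ sumBelow f X
sum-tail-zero _ zero    _    z≤n = refl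
sum-tail-zero X (suc Y) vanish X≤1+Y with m≤n⇒m<n∨m≡n X≤1+Y
... | inj₂ refl = refl
... | inj₁ X≤Y  = trans (cong₂ _+_ (sum-tail-zero X Y vanish (≤-pred X≤Y)) (vanish Y (≤-pred X≤Y)))
                        (+-identityʳ _)

sum-head : ∀ (f : ℕ → ℕ) N → sumBelow f (suc N) ≡ f 0 + sumBelow (λ k → f (suc k)) N
sum-head f zero    = +-comm 0 (f 0)
sum-head f (suc N) = trans (cong (_+ f (suc N)) (sum-head f N)) (+-assoc (f 0) _ _)

sum-+ : ∀ (f h : ℕ → ℕ) N → sumBelow (λ k → f k + h k) N ≡ sumBelow f N + sumBelow h N
sum-+ f h zero    = refl
sum-+ f h (suc N) = trans (cong (_+ (f N + h N)) (sum-+ f h N))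
                          (interchange (sumBelow f N) (sumBelow h N) (f N) (h N))

sum-const : ∀ a N → sumBelow (λ _ → a) N ≡ N * a
sum-const a zero    = refl
sum-const a (suc N) = trans (cong (_+ a) (sum-const a N)) (+-comm (N * a) a)

-- Abel rearrangement: Σ_{l<L} (l+1)·a_l = Σ_{j<L} Σ_{k<L-j} a_{j+k}, since a_l
-- occurs in the tail sum starting at j exactly for the l+1 values j ≤ l.
weighted-sum : ∀ (a : ℕ → ℕ) L →
  sumBelow (λ l → suc l * a l) L ≡ sumBelow (λ j → sumBelow (λ k → a (j + k)) (L ∸ j)) L
weighted-sum a zero    = refl
weighted-sum a (suc L) = begin
    sumBelow (λ l → suc l * a l) L + suc L * a L
  ≡⟨ cong (_+ suc L * a L) (weighted-sum a L) ⟩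
    tails L + suc L * a L
  ≡⟨ solve 3 (λ t x y → t :+ (x :+ y) := (t :+ y) :+ x) refl (tails L) (a L) (L * a L) ⟩
    (tails L + L * a L) + a L
  ≡⟨ cong₂ _+_ (cong (tails L +_) (sym (sum-const (a L) L))) (cong a (sym (+-identityʳ L))) ⟩
    (tails L + sumBelow (λ _ → a L) L) + a (L + 0)
  ≡⟨ cong₂ _+_ (sym (sum-+ (λ j → tail j (L ∸ j)) (λ _ → a L) L))
               (cong (tail L) (sym (m+n∸n≡m 1 L))) ⟩
    sumBelow (λ j → tail j (L ∸ j) + a L) L + tail L (suc L ∸ L)
  ≡⟨ cong (_+ tail L (suc L ∸ L)) (sum-cong< L extend) ⟩
    tails (suc L)
  ∎
  where
  open ≡-Reasoning
  tail : ℕ → ℕ → ℕ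
  tail j Z = sumBelow (λ k → a (j + k)) Z
  tails : ℕ → ℕ
  tails M = sumBelow (λ j → tail j (M ∸ j)) M
  extend : ∀ j → j < L → tail j (L ∸ j) + a L ≡ tail j (suc L ∸ j)
  extend j j<L = trans (cong (tail j (L ∸ j) +_) (cong a (sym (m+[n∸m]≡n (<⇒≤ j<L)))))
                       (cong (tail j) (sym (+-∸-assoc 1 (<⇒≤ j<L))))

weighted-sum-padded : ∀ (a : ℕ → ℕ) L Y Z → (∀ l → L ≤ l → a l ≡ 0) → L ≤ Y → L ≤ Z →
  sumBelow (λ l → suc l * a l) L ≡ sumBelow (λ j → sumBelow (λ k → a (j + k)) Z) Y
weighted-sum-padded a L Y Z vanish L≤Y L≤Z = begin
    sumBelow (λ l → suc l * a l) L
  ≡⟨ weighted-sum a L ⟩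
    sumBelow (λ j → sumBelow (λ k → a (j + k)) (L ∸ j)) L
  ≡⟨ sum-cong< L (λ j _ → sym (sum-tail-zero (L ∸ j) Z
       (λ k L∸j≤k → vanish (j + k) (≤-trans (m≤n+m∸n L j) (+-monoʳ-≤ j L∸j≤k)))
       (≤-trans (m∸n≤m L j) L≤Z))) ⟩
    sumBelow (λ j → sumBelow (λ k → a (j + k)) Z) L
  ≡⟨ sym (sum-tail-zero L Y
       (λ j L≤j → sum-zero Z (λ k _ → vanish (j + k) (≤-trans L≤j (m≤m+n j k)))) L≤Y) ⟩
    sumBelow (λ j → sumBelow (λ k → a (j + k)) Z) Y
  ∎
  where open ≡-Reasoning

if-true : ∀ {b : Bool} {x y : ℕ} → T b → (if b then x else y) ≡ x
if-true {true} _ = refl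

if-false : ∀ {b : Bool} {x y : ℕ} → ¬ T b → (if b then x else y) ≡ y
if-false {false} _  = refl
if-false {true}  ¬t = ⊥-elim (¬t _)

if-zero : ∀ (b : Bool) {x : ℕ} → x ≡ 0 → (if b then x else 0) ≡ 0
if-zero true  x≡0 = x≡0
if-zero false _   = refl

g-step : ∀ m p q → p < q →
  g (suc (suc m)) (suc p) (suc q) ≡ g (suc m) (suc p) (suc q) + sumBelow (λ i → g (suc m) i q) (suc p)
g-step m p q p<q = if-true (<⇒<ᵇ (s≤s p<q))

g-vanish-above : ∀ n p q → n < q → g n p q ≡ 0
g-vanish-above zero                 p       q             _         = refl
g-vanish-above (suc zero)           zero    (suc (suc q)) _         = refl
g-vanish-above (suc zero)           (suc p) (suc (suc q)) _         = refl
g-vanish-above (suc zero)           _       (suc zero)    (s≤s ())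
g-vanish-above (suc (suc m))        zero    (suc q)       (s≤s m<q) =
  cong₂ _+_ (g-vanish-above (suc m) 0 (suc q) (m<n⇒m<1+n m<q))
            (cong (sumBelow _) (m≤n⇒m∸n≡0 (<⇒≤ m<q)))
g-vanish-above (suc (suc m))        (suc p) (suc q)       (s≤s m<q) = if-zero (p <ᵇ q)
  (cong₂ _+_ (g-vanish-above (suc m) (suc p) (suc q) (m<n⇒m<1+n m<q))
             (sum-zero (suc p) (λ i _ → g-vanish-above (suc m) i q m<q)))

g-vanish-below : ∀ n p q → q ≤ p → g n p q ≡ 0
g-vanish-below zero          p       q    _   = refl
g-vanish-below (suc zero)    zero    zero _   = refl
g-vanish-below (suc zero)    (suc p) q    _   = refl
g-vanish-below (suc (suc m)) zero    zero _   = refl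
g-vanish-below (suc (suc m)) (suc p) q    q≤p = if-false (λ t → <⇒≱ (<ᵇ⇒< (suc p) q t) q≤p)

g-vanish-row : ∀ n p q → n ≤ p → g n p q ≡ 0
g-vanish-row n p q n≤p with <-cmp p q
... | tri< p<q _ _ = g-vanish-above n p q (≤-<-trans n≤p p<q)
... | tri≈ _ p≡q _ = g-vanish-below n p q (≤-reflexive (sym p≡q))
... | tri> _ _ q<p = g-vanish-below n p q (<⇒≤ q<p)

top-step : ∀ m i → (∀ j → suc j ≢ suc m → g (suc m) j (suc m) ≡ 0) →
  suc (suc i) ≢ suc (suc m) → g (suc (suc m)) (suc i) (suc (suc m)) ≡ 0
top-step m i previous ne with <-cmp i m
... | tri≈ _ i≡m _ = ⊥-elim (ne (cong (λ k → suc (suc k)) i≡m))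
... | tri> _ _ m<i = g-vanish-below (suc (suc m)) (suc i) (suc (suc m)) (s≤s m<i)
... | tri< i<m _ _ = trans (g-step m i (suc m) (m<n⇒m<1+n i<m))
  (cong₂ _+_ (g-vanish-above (suc m) (suc i) (suc (suc m)) ≤-refl)
             (sum-zero (suc i) (λ j j≤i → previous j
                (λ j≡m → <⇒≢ (≤-<-trans (≤-pred j≤i) i<m) (suc-injective j≡m)))))

g-vanish-top : ∀ n i → suc i ≢ n → g n i n ≡ 0
g-vanish-top zero          i       _  = refl
g-vanish-top (suc zero)    zero    ne = ⊥-elim (ne refl)
g-vanish-top (suc zero)    (suc i) _  = refl
g-vanish-top (suc (suc m)) zero    _  =
  cong₂ _+_ (g-vanish-above (suc m) 0 (suc (suc m)) ≤-refl) (cong (sumBelow _) (n∸n≡0 m))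
g-vanish-top (suc (suc m)) (suc i) ne = top-step m i (g-vanish-top (suc m)) ne

g-root : ∀ n → g (suc n) 0 1 ≡ 1
g-root zero    = refl
g-root (suc m) = cong₂ _+_ (g-root m)
  (sum-zero (suc m) (λ j _ → trans (cong (suc j *_) (g-vanish-below (suc m) (suc j) (suc j) ≤-refl))
                                   (*-zeroʳ (suc j))))

last-column-low : ∀ k → sumBelow (λ i → g (suc k) i (suc k)) k ≡ 0
last-column-low k = sum-zero k (λ i i<k → g-vanish-top (suc k) i (λ e → <⇒≢ i<k (suc-injective e)))

g-corner : ∀ n → g (suc n) n (suc n) ≡ 1
g-corner zero    = refl
g-corner (suc k) = trans (g-step k k (suc k) ≤-refl)
  (cong₂ _+_ (g-vanish-above (suc k) (suc k) (suc (suc k)) ≤-refl)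
             (cong₂ _+_ (last-column-low k) (g-corner k)))

diagonal : ℕ → ℕ → ℕ → ℕ
diagonal n r l = g n (suc l) (suc (suc (l + r)))

Shift Head ColumnRecurrence PartialSums DiagonalSums : ℕ → Set
Shift n = ∀ p r → p ≤ r → g n (suc p) (3 + r) ≡ g n (3 + p) (4 + r)
Head n = ∀ r → g n 0 (2 + r) ≡ sumBelow (λ j → diagonal n r (suc j)) n
ColumnRecurrence n = ∀ r → g n 0 (2 + r) ≡ g n 0 (3 + r) + g n 1 (3 + r) + g n 2 (3 + r)
PartialSums n = ∀ k r → k ≤ r →
  sumBelow (λ i → g n i (2 + r)) (suc k) ≡ sumBelow (λ i → g n i (3 + r)) (3 + k)
DiagonalSums n = ∀ r j Z → n ≤ suc j + Z →
  sumBelow (λ k → diagonal n r (j + k)) Z ≡ sumBelow (λ i → g n i (2 + (j + r))) (2 + j)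

-- Column recurrence: expand column r+2 of row 0 by Head, move its diagonal
-- back by one step with Shift, and recognise Head for column r+3.
column-recurrence : ∀ n → Shift n → Head n → ColumnRecurrence n
column-recurrence n shift head r = begin
    g n 0 (2 + r)
  ≡⟨ head r ⟩
    sumBelow h n
  ≡⟨ sum-tail-zero n (suc n) (λ j n≤j → g-vanish-row n (2 + j) _ (≤-trans n≤j (m≤n+m j 2)))
                     (n≤1+n n) ⟨
    sumBelow h (suc n)
  ≡⟨ sum-head h n ⟩
    h 0 + sumBelow (λ j → h (suc j)) n
  ≡⟨ cong (h 0 +_) (sum-cong (λ j → sym (shift j (j + r) (m≤m+n j r))) n) ⟩
    h 0 + sumBelow e n
  ≡⟨ cong (h 0 +_) (sum-tail-zero n (suc n) (λ j n≤j → g-vanish-row n (suc j) _ (≤-trans n≤j (n≤1+n j)))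
                                   (n≤1+n n)) ⟨
    h 0 + sumBelow e (suc n)
  ≡⟨ cong (h 0 +_) (sum-head e n) ⟩
    h 0 + (e 0 + sumBelow (λ j → e (suc j)) n)
  ≡⟨ cong (λ z → h 0 + (e 0 + z))
          (trans (sum-cong (λ j → cong (λ z → g n (2 + j) (3 + z)) (sym (+-suc j r))) n)
                 (sym (head (suc r)))) ⟩
    h 0 + (e 0 + g n 0 (3 + r))
  ≡⟨ solve 3 (λ x y z → x :+ (y :+ z) := z :+ y :+ x) refl (h 0) (e 0) (g n 0 (3 + r)) ⟩
    g n 0 (3 + r) + g n 1 (3 + r) + g n 2 (3 + r)
  ∎
  where
  open ≡-Reasoning
  h e : ℕ → ℕ
  h j = diagonal n r (suc j)
  e j = g n (suc j) (3 + (j + r))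

-- Partial column sums: adding Shift along column r+2 to the column recurrence.
partial-sums : ∀ n → Shift n → ColumnRecurrence n → PartialSums n
partial-sums n shift column zero    r _     = column r
partial-sums n shift column (suc k) (suc r) (s≤s k≤r) =
  cong₂ _+_ (partial-sums n shift column k (suc r) (m≤n⇒m≤1+n k≤r)) (shift k r k≤r)

-- Diagonal sums: iterating the partial-sum identity down a diagonal until it
-- leaves the table.
diagonal-sums : ∀ n → PartialSums n → DiagonalSums n
diagonal-sums n sums r j zero    n≤1+j+0 = sym (sum-zero (2 + j)
  (λ i _ → g-vanish-above n i _ (s≤s (≤-trans n≤1+j+0 (s≤s (+-monoʳ-≤ j z≤n))))))
diagonal-sums n sums r j (suc Z) n≤1+j+Z = begin
    sumBelow (λ k → δ (j + k)) (suc Z)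
  ≡⟨ sum-head (λ k → δ (j + k)) Z ⟩
    δ (j + 0) + sumBelow (λ k → δ (j + suc k)) Z
  ≡⟨ cong₂ _+_ (cong δ (+-identityʳ j)) (sum-cong (λ k → cong δ (+-suc j k)) Z) ⟩
    δ j + sumBelow (λ k → δ (suc j + k)) Z
  ≡⟨ cong (δ j +_) (diagonal-sums n sums r (suc j) Z (subst (n ≤_) (+-suc (suc j) Z) n≤1+j+Z)) ⟩
    δ j + sumBelow (λ i → g n i (3 + (j + r))) (3 + j)
  ≡⟨ cong (δ j +_) (sums j (j + r) (m≤m+n j r)) ⟨
    δ j + sumBelow (λ i → g n i (2 + (j + r))) (suc j)
  ≡⟨ +-comm (δ j) _ ⟩
    sumBelow (λ i → g n i (2 + (j + r))) (2 + j)
  ∎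
  where
  open ≡-Reasoning
  δ : ℕ → ℕ
  δ = diagonal n r

-- Shift at level m+2: both sides unfold to Shift plus a partial column sum
-- at level m+1.
shift-step : ∀ m → Shift (suc m) → PartialSums (suc m) → Shift (suc (suc m))
shift-step m shift sums p r p≤r = begin
    g (suc (suc m)) (suc p) (3 + r)
  ≡⟨ g-step m p (2 + r) (s≤s (≤-trans p≤r (n≤1+n r))) ⟩
    g (suc m) (suc p) (3 + r) + sumBelow (λ i → g (suc m) i (2 + r)) (suc p)
  ≡⟨ cong₂ _+_ (shift p r p≤r) (sums p r p≤r) ⟩
    g (suc m) (3 + p) (4 + r) + sumBelow (λ i → g (suc m) i (3 + r)) (3 + p)
  ≡⟨ g-step m (2 + p) (3 + r) (s≤s (s≤s (s≤s p≤r))) ⟨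
    g (suc (suc m)) (3 + p) (4 + r)
  ∎
  where open ≡-Reasoning

-- The weighted sum in the recursion for row 0 at level m+2 is, after the Abel
-- rearrangement, a sum of diagonal tails at level m+1, i.e. of partial column sums.
row-zero-increment : ∀ m r → DiagonalSums (suc m) →
  sumBelow (λ j → suc j * g (suc m) (suc j) (suc r + suc j)) (m ∸ r)
    ≡ sumBelow (λ j → sumBelow (λ i → g (suc m) i (2 + (j + r))) (2 + j)) (2 + m)
row-zero-increment m r diags = begin
    sumBelow (λ j → suc j * g (suc m) (suc j) (suc r + suc j)) (m ∸ r)
  ≡⟨ sum-cong (λ j → cong (λ z → suc j * g (suc m) (suc j) (suc z))
                          (trans (+-suc r j) (cong suc (+-comm r j)))) (m ∸ r) ⟩
    sumBelow (λ l → suc l * δ l) (m ∸ r)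
  ≡⟨ weighted-sum-padded δ (m ∸ r) (2 + m) (suc m) vanish
       (≤-trans (m∸n≤m m r) (m≤n+m m 2)) (≤-trans (m∸n≤m m r) (n≤1+n m)) ⟩
    sumBelow (λ j → sumBelow (λ k → δ (j + k)) (suc m)) (2 + m)
  ≡⟨ sum-cong (λ j → diags r j (suc m) (m≤n+m (suc m) (suc j))) (2 + m) ⟩
    sumBelow (λ j → sumBelow (λ i → g (suc m) i (2 + (j + r))) (2 + j)) (2 + m)
  ∎
  where
  open ≡-Reasoning
  δ : ℕ → ℕ
  δ = diagonal (suc m) r
  -- The diagonal leaves the table once its column l+r+2 exceeds m+1.
  vanish : ∀ l → m ∸ r ≤ l → δ l ≡ 0
  vanish l m∸r≤l = g-vanish-above (suc m) (suc l) _ (s≤s (s≤s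
    (≤-trans (m≤n+m∸n m r) (≤-trans (+-monoʳ-≤ r m∸r≤l) (≤-reflexive (+-comm r l))))))

-- Head at level m+2: the old row-0 entry and the new weighted sum combine,
-- diagonal entry by diagonal entry, into the recursion for g at level m+2.
head-step : ∀ m → Head (suc m) → DiagonalSums (suc m) → Head (suc (suc m))
head-step m head diags r = begin
    g (suc (suc m)) 0 (2 + r)
  ≡⟨⟩
    g (suc m) 0 (2 + r) + sumBelow (λ j → suc j * g (suc m) (suc j) (suc r + suc j)) (m ∸ r)
  ≡⟨ cong₂ _+_ head-padded (row-zero-increment m r diags) ⟩
    sumBelow (λ j → diagonal (suc m) r (suc j)) (2 + m)
      + sumBelow (λ j → sumBelow (λ i → g (suc m) i (2 + (j + r))) (2 + j)) (2 + m)
  ≡⟨ sum-+ _ _ (2 + m) ⟨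
    sumBelow (λ j → diagonal (suc m) r (suc j)
                    + sumBelow (λ i → g (suc m) i (2 + (j + r))) (2 + j)) (2 + m)
  ≡⟨ sum-cong (λ j → g-step m (suc j) (2 + (j + r)) (s≤s (s≤s (m≤m+n j r)))) (2 + m) ⟨
    sumBelow (λ j → diagonal (suc (suc m)) r (suc j)) (2 + m)
  ∎
  where
  open ≡-Reasoning
  head-padded : g (suc m) 0 (2 + r) ≡ sumBelow (λ j → diagonal (suc m) r (suc j)) (2 + m)
  head-padded = trans (head r) (sym (sum-tail-zero (suc m) (2 + m)
    (λ j m<j → g-vanish-row (suc m) (2 + j) _ (≤-trans m<j (m≤n+m j 2))) (n≤1+n (suc m))))

level-step : ∀ m → Shift (suc m) × Head (suc m) → Shift (suc (suc m)) × Head (suc (suc m))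
level-step m (shift , head) = shift-step m shift sums , head-step m head (diagonal-sums (suc m) sums)
  where
  sums : PartialSums (suc m)
  sums = partial-sums (suc m) shift (column-recurrence (suc m) shift head)

shift-and-head : ∀ n → Shift n × Head n
shift-and-head zero          = (λ _ _ _ → refl) , (λ _ → refl)
shift-and-head (suc zero)    = (λ _ _ _ → refl) , (λ _ → refl)
shift-and-head (suc (suc m)) = level-step m (shift-and-head (suc m))

g-shift : ∀ n → Shift n
g-shift n = proj₁ (shift-and-head n)

g-column-recurrence : ∀ n → ColumnRecurrence n
g-column-recurrence n = column-recurrence n (g-shift n) (proj₂ (shift-and-head n))

g-partial-sums : ∀ n → PartialSums n
g-partial-sums n = partial-sums n (g-shift n) (g-column-recurrence n)

-- Imported only here: the prefix +_ of ℤ would make the sections (x +_) above ambiguous.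
open import Data.Integer using (+_; _-_)
open import Data.Integer.Properties using ([+m]-[+n]≡m⊖n; ⊖-≥)

remove-summand : ∀ x y → + (x + y) - + y ≡ + x
remove-summand x y =
  trans ([+m]-[+n]≡m⊖n (x + y) y) (trans (⊖-≥ (m≤n+m y x)) (cong +_ (m+n∸n≡m x y)))

shift-at : ∀ n p q → 3 + p ≤ q → g n (suc p) q ≡ g n (3 + p) (suc q)
shift-at n p (suc (suc (suc r))) (s≤s (s≤s (s≤s p≤r))) = g-shift n p r p≤r

part-a : (n i : ℕ) → 2 ≤ i → i ≤ n → d n i ≡ d (n ∸ 1) i + c (n ∸ 1) (i ∸ 1)
part-a (suc (suc m)) (suc (suc i)) (s≤s (s≤s z≤n)) (s≤s (s≤s _)) = g-step m i (suc i) ≤-refl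

part-b : (n i : ℕ) → 1 ≤ n → i ≢ n ∸ 1 → g n i n ≡ 0
part-b (suc n) i _ i≢n = g-vanish-top (suc n) i (λ 1+i≡1+n → i≢n (suc-injective 1+i≡1+n))

part-c : (n : ℕ) → 1 ≤ n → g n 0 1 ≡ 1 × d n 1 ≡ 1 × c n 1 ≡ 1 × d n n ≡ 1 × c n n ≡ 1
part-c (suc n) _ =
  g-root n , g-root n , g-root n , g-corner n , cong₂ _+_ (last-column-low n) (g-corner n)

part-d : (n p q : ℕ) → 3 ≤ p + 2 → p + 2 < q + 1 → q + 1 ≤ n → g n p q ≡ g n (p + 2) (q + 1)
part-d n zero    q (s≤s (s≤s ())) _ _
part-d n (suc p) q _ p+3<q+1 _ rewrite +-comm p 2 | +-comm q 1 = shift-at n p q (≤-pred p+3<q+1)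

part-e : (n q : ℕ) → 2 ≤ q → q ≤ n ∸ 1 → g n 0 q ≡ g n 0 (q + 1) + g n 1 (q + 1) + g n 2 (q + 1)
part-e n (suc (suc r)) (s≤s (s≤s z≤n)) _ rewrite +-comm r 1 = g-column-recurrence n r

part-f : (n q k : ℕ) → 1 ≤ n → k ≤ q ∸ 2 → 2 ≤ q →
  sumBelow (λ i → g n i q) (k + 1) ≡ sumBelow (λ i → g n i (q + 1)) (k + 3)
part-f n (suc (suc r)) k _ k≤r (s≤s (s≤s z≤n)) rewrite +-comm k 1 | +-comm k 3 | +-comm r 1 =
  g-partial-sums n k r k≤r

-- c_{n,i+3} + d_{n,i+2} = c_{n,i+2} is the partial-sum identity for k = r = i.
part-g : (n i : ℕ) → 3 ≤ i → i ≤ n → + c n i ≡ + c n (i ∸ 1) - + d n (i ∸ 1)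
part-g n (suc (suc (suc i))) (s≤s (s≤s (s≤s z≤n))) _ = begin
    + c n (3 + i)
  ≡⟨ remove-summand (c n (3 + i)) (d n (2 + i)) ⟨
    + (c n (3 + i) + d n (2 + i)) - + d n (2 + i)
  ≡⟨ cong (λ z → + (z + d n (2 + i)) - + d n (2 + i)) (g-partial-sums n i i ≤-refl) ⟨
    + c n (2 + i) - + d n (2 + i)
  ∎
  where open ≡-Reasoning

lemma5 :
      ((n i : ℕ) → 2 ≤ i → i ≤ n → d n i ≡ d (n ∸ 1) i + c (n ∸ 1) (i ∸ 1))
    × ((n i : ℕ) → 1 ≤ n → i ≢ n ∸ 1 → g n i n ≡ 0)
    × ((n : ℕ) → 1 ≤ n →
         g n 0 1 ≡ 1 × d n 1 ≡ 1 × c n 1 ≡ 1 × d n n ≡ 1 × c n n ≡ 1)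
    × ((n p q : ℕ) → 3 ≤ p + 2 → p + 2 < q + 1 → q + 1 ≤ n → g n p q ≡ g n (p + 2) (q + 1))
    × ((n q : ℕ) → 2 ≤ q → q ≤ n ∸ 1 →
         g n 0 q ≡ g n 0 (q + 1) + g n 1 (q + 1) + g n 2 (q + 1))
    × ((n q k : ℕ) → 1 ≤ n → k ≤ q ∸ 2 → 2 ≤ q →
         sumBelow (λ i → g n i q) (k + 1) ≡ sumBelow (λ i → g n i (q + 1)) (k + 3))
    × ((n i : ℕ) → 3 ≤ i → i ≤ n → + c n i ≡ + c n (i ∸ 1) - + d n (i ∸ 1))
lemma5 = part-a , part-b , part-c , part-d , part-e , part-f , part-g
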